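{- Let $P[1\mathinner{.\,.} m]$ be a string that has a CT-block-period $p\in[1,\lfloor m/2\rfloor)$ and whose leftmost minimum is $P[m]$. For $i\in[1,m/p]$ let $c_i=m-(i-1)p$. Then for all $i\in[1,m/p]$, $P[c_i]$ is the leftmost minimum of $P[1\mathinner{.\,.} c_i]$.
   Context: Strings are over a totally ordered alphabet; $P[i]$ is the $i$-th character (1-indexed), $P[i\mathinner{.\,.} j]$ denotes $P[i]\cdots P[j]$. The leftmost minimum of a nonempty string $X$ is $X[j]$ for the smallest index $j$ at which the minimum value occurs. The Cartesian tree $\mathsf{CT}(X)$: empty for the empty string; otherwise a root with left subtree $\mathsf{CT}(X[1\mathinner{.\,.} j-1])$ and right subtree $\mathsf{CT}(X[j+1\mathinner{.\,.} |X|])$, where $X[j]$ is the leftmost minimum. $X\approx Y$ iff $\mathsf{CT}(X)=\mathsf{CT}(Y)$. A string $S[1\mathinner{.\,.} \ell]$ has CT-border-period $p\in[1,\ell]$ iff $S[1\mathinner{.\,.} \ell-p]\approx S[p+1\mathinner{.\,.} \ell]$; it has CT-block-period $p$ iff $p$ divides $\ell$, $p$ is a CT-border-period of $S$, and the leftmost minimum of $S$ is $S[1]$ or $S[\ell]$. -}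

module Defs where

open import Level using (Level)
open import Data.Nat using (ℕ; zero; suc; _+_; _*_; _∸_; _≤_; _<_)
open import Data.Nat.Divisibility using (_∣_)
open import Data.List using (List; []; _∷_; length; take; drop)
open import Data.Maybe using (Maybe; just; nothing)
open import Data.Product using (_×_; _,_)
open import Data.Sum using (_⊎_)
open import Relation.Nullary using (yes; no)
open import Relation.Binary.Bundles using (StrictTotalOrder)
open import Relation.Binary.PropositionalEquality using (_≡_)

data Tree : Set where
  leaf : Tree
  node : Tree → Tree → Tree

module Strings {c ℓ₁ ℓ₂ : Level} (O : StrictTotalOrder c ℓ₁ ℓ₂) where
  open StrictTotalOrder O renaming (Carrier to A)

  -- leftmost minimum of the nonempty string x ∷ xs:
  -- (0-based index, value). Replaces only on strictly smaller values,
  -- so the smallest index achieving the minimum is returned.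
  lm : A → List A → ℕ × A
  lm x [] = 0 , x
  lm x (y ∷ ys) with lm y ys
  ... | k , v with v <? x
  ...   | yes _ = suc k , v
  ...   | no  _ = 0 , x

  lmPos : List A → Maybe ℕ
  lmPos [] = nothing
  lmPos (x ∷ xs) with lm x xs
  ... | k , _ = just (suc k)

  -- Cartesian tree, with fuel (the fuel is the length, always sufficient)
  CT′ : ℕ → List A → Tree
  CT′ _ [] = leaf
  CT′ zero (_ ∷ _) = leaf
  CT′ (suc n) (x ∷ xs) with lm x xs
  ... | k , _ = node (CT′ n (take k (x ∷ xs))) (CT′ n (drop (suc k) (x ∷ xs)))

  CT : List A → Tree
  CT xs = CT′ (length xs) xs

  _≈CT_ : List A → List A → Set
  X ≈CT Y = CT X ≡ CT Y

  prefix : ℕ → List A → List A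
  prefix k S = take k S

  CTBorderPeriod : List A → ℕ → Set
  CTBorderPeriod S p = (1 ≤ p) × (p ≤ length S)
                       × (take (length S ∸ p) S ≈CT drop p S)

  CTBlockPeriod : List A → ℕ → Set
  CTBlockPeriod S p = (p ∣ length S) × CTBorderPeriod S p
                      × ((lmPos S ≡ just 1) ⊎ (lmPos S ≡ just (length S)))

{-# OPTIONS --safe #-}
-- The position of the leftmost minimum of a prefix X[1..k] depends only on CT(X): if
-- the root of CT(X) is X[r+1], the answer is r+1 when k > r and is otherwise read off
-- the left subtree. So CT-equivalent strings agree on the leftmost-minimum position
-- of every prefix. If a string ends with its leftmost minimum, so does each of its
-- suffixes. Hence if P[1..c] ends with its leftmost minimum and p < c, so does
-- P[p+1..c], a prefix of P[p+1..m]; moving it across P[1..m-p] ≈ P[p+1..m] shows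
-- that P[1..c-p] ends with its leftmost minimum. Induct from c₁ = m.
module Submission where

open import Defs
open import Level using (Level)
open import Data.Nat using (ℕ; _*_; _∸_; _≤_; _<_; _/_; NonZero)
open import Data.List using (List; length; take)
open import Data.Maybe using (just)
open import Relation.Binary.Bundles using (StrictTotalOrder)
open import Relation.Binary.PropositionalEquality using (_≡_)

open import Data.Nat using (zero; suc; _+_; z≤n; s≤s; _≤?_)
open import Data.Nat.Properties
open import Data.Nat.DivMod using (m/n*n≤m)
open import Data.List using ([]; _∷_; drop)
open import Data.List.Properties using (length-take; length-drop; take-take; take-drop; take-all)
open import Data.List.Relation.Unary.All as All using (All; []; _∷_)
open import Data.List.Relation.Unary.All.Properties using (take⁺)
open import Data.List.Relation.Unary.Any using (here; there)
open import Data.List.Membership.Propositional using (_∈_)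
open import Data.Maybe using (Maybe; nothing)
open import Data.Maybe.Properties using (just-injective)
open import Data.Product using (_,_; proj₁; proj₂)
open import Data.Empty using (⊥-elim)
open import Relation.Nullary using (yes; no; ¬_)
open import Relation.Binary.Definitions using (tri<; tri≈; tri>)
open import Relation.Binary.PropositionalEquality using (refl; sym; trans; cong; cong₂; subst; module ≡-Reasoning)

length-take-≤ : ∀ {a} {A : Set a} {n} (xs : List A) → n ≤ length xs → length (take n xs) ≡ n
length-take-≤ {n = n} xs n≤ = trans (length-take n xs) (m≤n⇒m⊓n≡m n≤)

take-take-≤ : ∀ {a} {A : Set a} {m n} (xs : List A) → m ≤ n → take m (take n xs) ≡ take m xs
take-take-≤ {m = m} {n} xs m≤n = trans (take-take m n xs) (cong (λ j → take j xs) (m≤n⇒m⊓n≡m m≤n))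

size : Tree → ℕ
size leaf = 0
size (node L R) = suc (size L + size R)

prefixLmPos : Tree → ℕ → Maybe ℕ
prefixLmPos leaf k = nothing
prefixLmPos (node L R) k with k ≤? size L
... | yes _ = prefixLmPos L k
... | no _ = just (suc (size L))

module _ {c ℓ₁ ℓ₂ : Level} (O : StrictTotalOrder c ℓ₁ ℓ₂) where
  open StrictTotalOrder O using (module Eq; compare; irrefl; <-resp-≈)
    renaming (Carrier to A; _<_ to _≺_; _<?_ to _≺?_; trans to ≺-trans)
  open Strings O

  ≺-irrefl : ∀ {a} → ¬ a ≺ a
  ≺-irrefl = irrefl Eq.refl

  ≮-trans : ∀ {x y z} → ¬ x ≺ y → ¬ y ≺ z → ¬ x ≺ z
  ≮-trans {y = y} {z} x≮y y≮z x<z with compare y z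
  ... | tri< y<z _ _ = y≮z y<z
  ... | tri≈ _ y≈z _ = x≮y (proj₁ <-resp-≈ (Eq.sym y≈z) x<z)
  ... | tri> _ _ z<y = x≮y (≺-trans x<z z<y)

  lm-≤-length : ∀ x xs → proj₁ (lm x xs) ≤ length xs
  lm-≤-length x [] = z≤n
  lm-≤-length x (y ∷ ys) with proj₂ (lm y ys) ≺? x
  ... | yes _ = s≤s (lm-≤-length y ys)
  ... | no _ = z≤n

  lm-minimal : ∀ x xs → All (λ z → ¬ z ≺ proj₂ (lm x xs)) (x ∷ xs)
  lm-minimal x [] = ≺-irrefl ∷ []
  lm-minimal x (y ∷ ys) with proj₂ (lm y ys) ≺? x
  ... | yes v<x = (λ x<v → ≺-irrefl (≺-trans x<v v<x)) ∷ lm-minimal y ys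
  ... | no v≮x = ≺-irrefl ∷ All.map (λ z≮v → ≮-trans z≮v v≮x) (lm-minimal y ys)

  lm-∈ : ∀ x xs → proj₂ (lm x xs) ∈ x ∷ xs
  lm-∈ x [] = here refl
  lm-∈ x (y ∷ ys) with proj₂ (lm y ys) ≺? x
  ... | yes _ = there (lm-∈ y ys)
  ... | no _ = here refl

  lm-take-≮ : ∀ x xs n → ¬ proj₂ (lm x (take n xs)) ≺ proj₂ (lm x xs)
  lm-take-≮ x xs n = All.lookup (take⁺ (suc n) (lm-minimal x xs)) (lm-∈ x (take n xs))

  lm-take : ∀ x xs n → proj₁ (lm x xs) ≤ n → lm x (take n xs) ≡ lm x xs
  lm-take x [] zero _ = refl
  lm-take x [] (suc n) _ = refl
  lm-take x (y ∷ ys) n le with proj₂ (lm y ys) ≺? x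
  lm-take x (y ∷ ys) (suc n) (s≤s le) | yes v<x with proj₂ (lm y (take n ys)) ≺? x
  ... | yes _ = cong (λ q → suc (proj₁ q) , proj₂ q) (lm-take y ys n le)
  ... | no v′≮x = ⊥-elim (v′≮x (subst (λ q → proj₂ q ≺ x) (sym (lm-take y ys n le)) v<x))
  lm-take x (y ∷ ys) zero le | no v≮x = refl
  lm-take x (y ∷ ys) (suc n) le | no v≮x with proj₂ (lm y (take n ys)) ≺? x
  ... | yes v′<x = ⊥-elim (≮-trans (lm-take-≮ y ys n) v≮x v′<x)
  ... | no _ = refl

  length-take-lm : ∀ x xs → length (take (proj₁ (lm x xs)) (x ∷ xs)) ≡ proj₁ (lm x xs)
  length-take-lm x xs = length-take-≤ (x ∷ xs) (m≤n⇒m≤1+n (lm-≤-length x xs))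

  length-take-lm-≤ : ∀ {n} x xs → length xs ≤ n → length (take (proj₁ (lm x xs)) (x ∷ xs)) ≤ n
  length-take-lm-≤ x xs len≤n = subst (_≤ _) (sym (length-take-lm x xs)) (≤-trans (lm-≤-length x xs) len≤n)

  size-CT′ : ∀ n xs → length xs ≤ n → size (CT′ n xs) ≡ length xs
  size-CT′ zero [] _ = refl
  size-CT′ (suc n) [] _ = refl
  size-CT′ (suc n) (x ∷ xs) (s≤s len≤n) = cong suc (begin
      size (CT′ n (take r (x ∷ xs))) + size (CT′ n (drop r xs))
    ≡⟨ cong₂ _+_ (trans (size-CT′ n (take r (x ∷ xs)) (length-take-lm-≤ x xs len≤n)) (length-take-lm x xs))
                 (trans (size-CT′ n (drop r xs) right≤n) (length-drop r xs)) ⟩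
      r + (length xs ∸ r)
    ≡⟨ m+[n∸m]≡n (lm-≤-length x xs) ⟩
      length xs ∎)
    where
    open ≡-Reasoning
    r = proj₁ (lm x xs)
    right≤n : length (drop r xs) ≤ n
    right≤n = subst (_≤ n) (sym (length-drop r xs)) (≤-trans (m∸n≤m _ r) len≤n)

  size-CT′-take-lm : ∀ n x xs → length xs ≤ n
                   → size (CT′ n (take (proj₁ (lm x xs)) (x ∷ xs))) ≡ proj₁ (lm x xs)
  size-CT′-take-lm n x xs len≤n = trans (size-CT′ n _ (length-take-lm-≤ x xs len≤n)) (length-take-lm x xs)

  lmPos-take-beyond-lm : ∀ x xs k → proj₁ (lm x xs) < k
                       → lmPos (take k (x ∷ xs)) ≡ just (suc (proj₁ (lm x xs)))
  lmPos-take-beyond-lm x xs (suc k) (s≤s r≤k) = cong (λ q → just (suc (proj₁ q))) (lm-take x xs k r≤k)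

  lmPos-take-CT′ : ∀ n xs k → length xs ≤ n → lmPos (take k xs) ≡ prefixLmPos (CT′ n xs) k
  lmPos-take-CT′ zero [] zero _ = refl
  lmPos-take-CT′ zero [] (suc k) _ = refl
  lmPos-take-CT′ (suc n) [] zero _ = refl
  lmPos-take-CT′ (suc n) [] (suc k) _ = refl
  lmPos-take-CT′ (suc n) (x ∷ xs) k (s≤s len≤n) with k ≤? size (CT′ n (take (proj₁ (lm x xs)) (x ∷ xs)))
  ... | yes k≤size = begin
      lmPos (take k (x ∷ xs))                  ≡⟨ cong lmPos (take-take-≤ (x ∷ xs) k≤r) ⟨
      lmPos (take k (take r (x ∷ xs)))         ≡⟨ lmPos-take-CT′ n (take r (x ∷ xs)) k (length-take-lm-≤ x xs len≤n) ⟩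
      prefixLmPos (CT′ n (take r (x ∷ xs))) k  ∎
    where
    open ≡-Reasoning
    r = proj₁ (lm x xs)
    k≤r : k ≤ r
    k≤r = subst (k ≤_) (size-CT′-take-lm n x xs len≤n) k≤size
  ... | no k≰size = begin
      lmPos (take k (x ∷ xs))                        ≡⟨ lmPos-take-beyond-lm x xs k r<k ⟩
      just (suc r)                                   ≡⟨ cong (λ j → just (suc j)) (size-CT′-take-lm n x xs len≤n) ⟨
      just (suc (size (CT′ n (take r (x ∷ xs)))))    ∎
    where
    open ≡-Reasoning
    r = proj₁ (lm x xs)
    r<k : r < k
    r<k = ≰⇒> (λ k≤r → k≰size (subst (k ≤_) (sym (size-CT′-take-lm n x xs len≤n)) k≤r))

  ≈CT⇒lmPos-take≡ : ∀ {X Y} → X ≈CT Y → ∀ k → lmPos (take k X) ≡ lmPos (take k Y)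
  ≈CT⇒lmPos-take≡ {X} {Y} X≈Y k = begin
      lmPos (take k X)               ≡⟨ lmPos-take-CT′ (length X) X k ≤-refl ⟩
      prefixLmPos (CT X) k           ≡⟨ cong (λ t → prefixLmPos t k) X≈Y ⟩
      prefixLmPos (CT Y) k           ≡⟨ lmPos-take-CT′ (length Y) Y k ≤-refl ⟨
      lmPos (take k Y)               ∎
    where open ≡-Reasoning

  lmPos-tail-last : ∀ x y ys → lmPos (x ∷ y ∷ ys) ≡ just (length (x ∷ y ∷ ys))
                  → lmPos (y ∷ ys) ≡ just (length (y ∷ ys))
  lmPos-tail-last x y ys last with proj₂ (lm y ys) ≺? x
  lmPos-tail-last x y ys last | yes _ = cong just (suc-injective (just-injective last))
  lmPos-tail-last x y ys ()   | no _

  lmPos-drop-last : ∀ d S → lmPos S ≡ just (length S) → d < length S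
                  → lmPos (drop d S) ≡ just (length S ∸ d)
  lmPos-drop-last zero S last _ = last
  lmPos-drop-last (suc d) (x ∷ []) _ (s≤s ())
  lmPos-drop-last (suc d) (x ∷ y ∷ ys) last (s≤s d<len) =
    lmPos-drop-last d (y ∷ ys) (lmPos-tail-last x y ys last) d<len

  lmPos-take-shift : ∀ {P p c} → take (length P ∸ p) P ≈CT drop p P → p < c → c ≤ length P
                   → lmPos (take c P) ≡ just c → lmPos (take (c ∸ p) P) ≡ just (c ∸ p)
  lmPos-take-shift {P} {p} {c} border p<c c≤len last = begin
      lmPos (take (c ∸ p) P)                        ≡⟨ cong lmPos (take-take-≤ P (∸-monoˡ-≤ p c≤len)) ⟨
      lmPos (take (c ∸ p) (take (length P ∸ p) P))  ≡⟨ ≈CT⇒lmPos-take≡ border (c ∸ p) ⟩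
      lmPos (take (c ∸ p) (drop p P))               ≡⟨ cong lmPos take-drop-take ⟩
      lmPos (drop p (take c P))                     ≡⟨ lmPos-drop-last p (take c P) last′ (subst (p <_) (sym len) p<c) ⟩
      just (length (take c P) ∸ p)                  ≡⟨ cong (λ j → just (j ∸ p)) len ⟩
      just (c ∸ p)                                  ∎
    where
    open ≡-Reasoning
    len : length (take c P) ≡ c
    len = length-take-≤ P c≤len
    last′ : lmPos (take c P) ≡ just (length (take c P))
    last′ = subst (λ j → lmPos (take c P) ≡ just j) (sym len) last
    take-drop-take : take (c ∸ p) (drop p P) ≡ drop p (take c P)
    take-drop-take = trans (take-drop (c ∸ p) p P) (cong (λ j → drop p (take j P)) (m+[n∸m]≡n (<⇒≤ p<c)))

  lmPos-take-periods : ∀ {P p} → 1 ≤ p → take (length P ∸ p) P ≈CT drop p P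
                     → lmPos P ≡ just (length P)
                     → ∀ t → suc t * p ≤ length P
                     → lmPos (take (length P ∸ t * p) P) ≡ just (length P ∸ t * p)
  lmPos-take-periods {P} _ _ last zero _ =
    subst (λ Q → lmPos Q ≡ just (length P)) (sym (take-all (length P) P ≤-refl)) last
  lmPos-take-periods {P} {p} 1≤p border last (suc t) t+2≤ =
    subst (λ j → lmPos (take j P) ≡ just j) c∸p≡
      (lmPos-take-shift border p<c (m∸n≤m m (t * p))
        (lmPos-take-periods 1≤p border last t (≤-trans (m≤n+m (suc t * p) p) t+2≤)))
    where
    m = length P
    p<c : p < m ∸ t * p
    p<c = m+n≤o⇒m≤o∸n (suc p) (≤-trans (+-monoˡ-≤ (p + t * p) 1≤p) t+2≤)
    c∸p≡ : m ∸ t * p ∸ p ≡ m ∸ suc t * p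
    c∸p≡ = trans (∸-+-assoc m (t * p) p) (cong (m ∸_) (+-comm (t * p) p))

lemma34 : ∀ {c ℓ₁ ℓ₂ : Level} (O : StrictTotalOrder c ℓ₁ ℓ₂)
    → let open Strings O in
      (P : List (StrictTotalOrder.Carrier O)) (m p : ℕ) .{{_ : NonZero p}}
    → length P ≡ m
    → CTBlockPeriod P p
    → p < m / 2
    → lmPos P ≡ just m
    → (i : ℕ) → 1 ≤ i → i ≤ m / p
    → lmPos (take (m ∸ (i ∸ 1) * p) P) ≡ just (m ∸ (i ∸ 1) * p)
lemma34 O P .(length P) p refl (_ , (1≤p , _ , border) , _) _ last (suc t) _ i≤m/p =
  lmPos-take-periods O 1≤p border last t (≤-trans (*-monoˡ-≤ p i≤m/p) (m/n*n≤m (length P) p))
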